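{- In the setting described in the context, for every edge $e_C\in E(C)$ of the form $e_C=p_{AC}(e_C)\times\{x_{BC}\}$ with $x_{BC}\in V(BC)$ (i.e. all vertices of $e_C$ have the same $BC$-coordinate $x_{BC}$), it holds that $p_{AC}(e_C)\in E(AC)$. Analogous statements hold for the hypergraphs $AD$, $BC$, $BD$ with the respective edges.
   Context: Hypergraphs $(V,E)$ are finite ($E$ a set of nonempty subsets of $V$), simple ($|e|\ge2$, no edge properly contained in another) and connected; $N[v]$ is $v$ with all vertices sharing an edge with $v$; thin means $N[u]\ne N[v]$ for $u\ne v$. Products of $H_1=(V_1,E_1),H_2=(V_2,E_2)$ have vertex set $V_1\times V_2$, projections $p_i$. Cartesian product $\Box$: $e$ edge iff for some $\{i,j\}=\{1,2\}$, $p_i(e)\in E_i$, $|p_j(e)|=1$. Strong product $\boxtimes_{\max}$: edges of $\Box$, plus $e$ with $p_i(e)\in E_i$ ($i=1,2$) and $|e|=\max_i|p_i(e)|$. Normal product $\boxtimes_{\min}$: edges of $\Box$, plus $e$ with $p_i(e)\subseteq e_i\in E_i$ ($i=1,2$) and $|e|=|p_1(e)|=|p_2(e)|=\min\{|e_1|,|e_2|\}$. An edge is dispensable if there are $z$ and distinct $x,y\in e$ with (1) $N[x]\cap N[y]\subsetneq N[x]\cap N[z]$ or $N[x]\subsetneq N[z]\subsetneq N[y]$ and (2) $N[x]\cap N[y]\subsetneq N[y]\cap N[z]$ or $N[y]\subsetneq N[z]\subsetneq N[x]$; the Cartesian skeleton $S(H)$ is $H$ with dispensable edges removed. Setting: $\boxtimes\in\{\boxtimes_{\min},\boxtimes_{\max}\}$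 is fixed; $H$ is thin and $H\cong A\boxtimes B\cong C\boxtimes D$. Let $S(H)=\Box_{i\in I}H_i$ be the prime factor decomposition of $S(H)$ w.r.t. $\Box$, so $V(H)=\times_{i\in I}V(H_i)$. Since $S(H)=S(A)\Box S(B)=S(C)\Box S(D)$, there are partitions $I=I_A\sqcup I_B=I_C\sqcup I_D$ with $V(A)=\times_{i\in I_A}V(H_i)$, etc., the projection $p_A:V(H)\to V(A)$ being the projection to the coordinates in $I_A$ (similarly $p_B,p_C,p_D$). It is assumed that $I_A\cap I_C$, $I_A\cap I_D$, $I_B\cap I_C$ are nonempty (only $I_B\cap I_D$ may be empty). Put $V(AC)=\times_{i\in I_A\cap I_C}V(H_i)$ and similarly $V(AD),V(BC),V(BD)$. Each $x\in V(H)$ has coordinates $(x_{AC},x_{AD},x_{BC},x_{BD})$, with $x_A=(x_{AC},x_{AD})$, $x_B=(x_{BC},x_{BD})$, $x_C=(x_{AC},x_{BC})$, $x_D=(x_{AD},x_{BD})$; $p_{AC}$ denotes the projection onto the $AC$-coordinate, defined on $V(H)$, $V(A)$, $V(C)$ compatibly (similarly $p_{AD},p_{BC},p_{BD}$); projections of sets are images; $X\times\{x_{BC}\}$ for $X\subseteq V(AC)$ denotes the set of vertices of $C$ with $AC$-coordinate in $X$ and $BC$-coordinate $x_{BC}$. Define $E(AC)=\{e_{AC}\subseteq V(AC): e_{AC}=p_{AC}(e_H)$ for some $e_H\in E(H)$ such that there is no $e'_H\in E(H)$ with $p_{AC}(e_H)\subsetneq p_{AC}(e'_H)\}$, and $E(AD),E(BC),E(BD)$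 analogously. -}

module Defs where

open import Data.Nat using (ℕ; zero; suc; _≤_; _⊔_; _⊓_)
open import Data.Bool using (Bool; true; false; T; not; _∧_; if_then_else_)
open import Data.Fin using (Fin)
open import Data.List using (List; []; _∷_; length)
open import Data.Bool.ListAction using (any)
open import Data.List.Membership.Propositional using (_∈_)
open import Data.List.Relation.Unary.Unique.Propositional using (Unique)
open import Data.Product using (Σ; ∃; ∃-syntax; _×_; _,_)
open import Data.Sum using (_⊎_)
open import Relation.Nullary using (¬_; ⌊_⌋)
open import Relation.Binary.PropositionalEquality using (_≡_; _≢_)
open import Relation.Binary.Definitions using (DecidableEquality)
open import Relation.Unary using (Pred; _⊆_; _⊂_; _∩_; _≐_)
open import Function.Bundles using (_⇔_)

Subset : Set → Set
Subset X = X → Bool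

countB : {X : Set} → (X → Bool) → List X → ℕ
countB e []       = 0
countB e (x ∷ xs) = if e x then suc (countB e xs) else countB e xs

data Walk {V : Set} (E : Subset V → Set) : V → V → Set where
  here : ∀ {x} → Walk E x x
  step : ∀ {x y z} (e : Subset V) → E e → T (e x) → T (e y) →
         Walk E y z → Walk E x z

-- Finite, simple, connected hypergraphs.
-- 'vertices' is a duplicate-free complete listing of V (finiteness);
-- E is the set of edges (a predicate on subsets, extensional).

record Hypergraph : Set₁ where
  field
    V          : Set
    _≟_        : DecidableEquality V
    vertices   : List V
    unique     : Unique vertices
    complete   : ∀ v → v ∈ vertices
    E          : Subset V → Set
    E-ext      : ∀ {e e'} → (∀ v → e v ≡ e' v) → E e → E e'
    E-size     : ∀ {e} → E e → 2 ≤ countB e vertices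
    E-antichain : ∀ {e e'} → E e → E e' → (∀ v → T (e v) → T (e' v)) →
                  ∀ v → e v ≡ e' v
    someVertex : V
    connected  : ∀ x y → Walk E x y

open Hypergraph public

order : Hypergraph → ℕ
order G = length (vertices G)

card : (G : Hypergraph) → Subset (V G) → ℕ
card G e = countB e (vertices G)

img : (G G' : Hypergraph) → (V G → V G') → Subset (V G) → Subset (V G')
img G G' f e y = any (λ x → e x ∧ ⌊ _≟_ G' (f x) y ⌋) (vertices G)

_⊆ᵇ_ : {X : Set} → Subset X → Subset X → Set
e ⊆ᵇ e' = ∀ v → T (e v) → T (e' v)

N[_]_ : (H : Hypergraph) → V H → Pred (V H) _
N[ H ] v = λ u → u ≡ v ⊎ Σ (Subset (V H)) (λ e → E H e × T (e v) × T (e u))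

Thin : Hypergraph → Set
Thin H = ∀ u v → u ≢ v → ¬ ((N[ H ] u) ≐ (N[ H ] v))

Dispensable : (H : Hypergraph) → Subset (V H) → Set
Dispensable H e = Σ (V H) λ z → Σ (V H) λ x → Σ (V H) λ y →
  x ≢ y × T (e x) × T (e y) ×
  ((((N[ H ] x) ∩ (N[ H ] y)) ⊂ ((N[ H ] x) ∩ (N[ H ] z)))
     ⊎ ((N[ H ] x) ⊂ (N[ H ] z) × (N[ H ] z) ⊂ (N[ H ] y))) ×
  ((((N[ H ] x) ∩ (N[ H ] y)) ⊂ ((N[ H ] y) ∩ (N[ H ] z)))
     ⊎ ((N[ H ] y) ⊂ (N[ H ] z) × (N[ H ] z) ⊂ (N[ H ] x)))

SkelEdge : (H : Hypergraph) → Subset (V H) → Set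
SkelEdge H e = E H e × ¬ Dispensable H e

-- Products.  'IsProduct k G G₁ G₂ φ₁ φ₂' says that x ↦ (φ₁ x , φ₂ x) is
-- an isomorphism from G onto the product G₁ ∗ G₂ of kind k; the
-- projections p_i(e) of a subset e of V(G) are the images under φ_i.

data ProductKind : Set where
  cartesian normal strong : ProductKind

data StrongLike : Set where
  ⊠min ⊠max : StrongLike

kindOf : StrongLike → ProductKind
kindOf ⊠min = normal
kindOf ⊠max = strong

ProductEdge : ProductKind → (G G₁ G₂ : Hypergraph) →
              (V G → V G₁) → (V G → V G₂) → Subset (V G) → Set
ProductEdge k G G₁ G₂ φ₁ φ₂ e = cart ⊎ extra k
  where
  a = img G G₁ φ₁ e
  b = img G G₂ φ₂ e
  cart = (E G₁ a × card G₂ b ≡ 1) ⊎ (E G₂ b × card G₁ a ≡ 1)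
  extra : ProductKind → Set
  extra cartesian = Data.Empty.⊥
    where import Data.Empty
  extra strong = E G₁ a × E G₂ b × card G e ≡ card G₁ a ⊔ card G₂ b
  extra normal = Σ (Subset (V G₁)) λ e₁ → Σ (Subset (V G₂)) λ e₂ →
    E G₁ e₁ × E G₂ e₂ × a ⊆ᵇ e₁ × b ⊆ᵇ e₂ ×
    card G e ≡ card G₁ e₁ ⊓ card G₂ e₂ ×
    card G₁ a ≡ card G₁ e₁ ⊓ card G₂ e₂ ×
    card G₂ b ≡ card G₁ e₁ ⊓ card G₂ e₂

IsProduct : ProductKind → (G G₁ G₂ : Hypergraph) →
            (V G → V G₁) → (V G → V G₂) → Set
IsProduct k G G₁ G₂ φ₁ φ₂ =
  (∀ x y → φ₁ x ≡ φ₁ y → φ₂ x ≡ φ₂ y → x ≡ y) ×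
  (∀ a b → Σ (V G) λ x → φ₁ x ≡ a × φ₂ x ≡ b) ×
  (∀ e → E G e ⇔ ProductEdge k G G₁ G₂ φ₁ φ₂ e)

Prime : Hypergraph → Set₁
Prime G = 2 ≤ order G ×
  (∀ (G₁ G₂ : Hypergraph) (φ₁ : V G → V G₁) (φ₂ : V G → V G₂) →
     IsProduct cartesian G G₁ G₂ φ₁ φ₂ → order G₁ ≡ 1 ⊎ order G₂ ≡ 1)

-- Coordinates.  Given factors Hs : Fin m → Hypergraph and an index set
-- J ⊆ Fin m, ρ identifies X with the product ×_{i∈J} V(Hs i).

CoordIso : {m : ℕ} (Hs : Fin m → Hypergraph) (J : Fin m → Bool) {X : Set} →
           ((i : Fin m) → T (J i) → X → V (Hs i)) → Set
CoordIso {m} Hs J {X} ρ =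
  (∀ a a' → (∀ i h → ρ i h a ≡ ρ i h a') → a ≡ a') ×
  (∀ (f : (i : Fin m) → T (J i) → V (Hs i)) →
     Σ X λ a → ∀ i h → ρ i h a ≡ f i h)

-- The setting.  B has index set I_B = complement of I_A, D has
-- I_D = complement of I_C.

record Setting : Set₁ where
  field
    ⊠        : StrongLike
    H        : Hypergraph
    thin     : Thin H
    -- prime factor decomposition S(H) = □_{i ∈ Fin m} Hs i
    m        : ℕ
    Hs       : Fin m → Hypergraph
    Hs-prime : ∀ i → Prime (Hs i)
    π        : (i : Fin m) → V H → V (Hs i)
    π-iso    : CoordIso Hs (λ _ → true) (λ i _ → π i)
    S-cart   : ∀ (e : Subset (V H)) →
               SkelEdge H e ⇔
               (Σ (Fin m) λ i → E (Hs i) (img H (Hs i) (π i) e) ×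
                  (∀ j → j ≢ i → card (Hs j) (img H (Hs j) (π j) e) ≡ 1))
    I-A I-C  : Fin m → Bool
    A B C D  : Hypergraph
    ρA : (i : Fin m) → T (I-A i) → V A → V (Hs i)
    ρB : (i : Fin m) → T (not (I-A i)) → V B → V (Hs i)
    ρC : (i : Fin m) → T (I-C i) → V C → V (Hs i)
    ρD : (i : Fin m) → T (not (I-C i)) → V D → V (Hs i)
    ρA-iso : CoordIso Hs I-A ρA
    ρB-iso : CoordIso Hs (λ i → not (I-A i)) ρB
    ρC-iso : CoordIso Hs I-C ρC
    ρD-iso : CoordIso Hs (λ i → not (I-C i)) ρD
    pA : V H → V A
    pB : V H → V B
    pC : V H → V C
    pD : V H → V D
    pA-coord : ∀ x i h → ρA i h (pA x) ≡ π i x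
    pB-coord : ∀ x i h → ρB i h (pB x) ≡ π i x
    pC-coord : ∀ x i h → ρC i h (pC x) ≡ π i x
    pD-coord : ∀ x i h → ρD i h (pD x) ≡ π i x
    H≅A⊠B : IsProduct (kindOf ⊠) H A B pA pB
    H≅C⊠D : IsProduct (kindOf ⊠) H C D pC pD
    AC≠∅ : Σ (Fin m) λ i → T (I-A i) × T (I-C i)
    AD≠∅ : Σ (Fin m) λ i → T (I-A i) × T (not (I-C i))
    BC≠∅ : Σ (Fin m) λ i → T (not (I-A i)) × T (I-C i)

-- Block hypergraph XY (X ∈ {A,B} with index set IX, Y ∈ {C,D} with
-- index set IY and coordinates ρY).  V(XY) = ×_{i ∈ IX ∩ IY} V(Hs i);
-- two vertices have the same image under p_XY iff they agree in all
-- coordinates i ∈ IX ∩ IY.  Images of sets are compared through this.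

module Block (S : Setting) where
  open Setting S

  module _ (IX : Fin m → Bool) (Y : Hypergraph) (IY : Fin m → Bool)
           (ρY : (i : Fin m) → T (IY i) → V Y → V (Hs i)) where

    -- p_XY(x) = p_XY(y) for x, y ∈ V(H)
    AgreeHH : V H → V H → Set
    AgreeHH x y = ∀ i → T (IX i) → T (IY i) → π i x ≡ π i y

    -- p_XY(x) = p_XY(v) for x ∈ V(H), v ∈ V(Y)
    AgreeHY : V H → V Y → Set
    AgreeHY x v = ∀ i → T (IX i) → (hY : T (IY i)) → π i x ≡ ρY i hY v

    -- p_XY(e) ⊆ p_XY(e') for e, e' ⊆ V(H)
    ImgSubHH : Subset (V H) → Subset (V H) → Set
    ImgSubHH e e' = ∀ x → T (e x) → Σ (V H) λ y → T (e' y) × AgreeHH x y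

    ImgStrictHH : Subset (V H) → Subset (V H) → Set
    ImgStrictHH e e' = ImgSubHH e e' × ¬ ImgSubHH e' e

    -- p_XY(e) = p_XY(f) for e ⊆ V(H), f ⊆ V(Y)
    ImgEqHY : Subset (V H) → Subset (V Y) → Set
    ImgEqHY e f = (∀ x → T (e x) → Σ (V Y) λ v → T (f v) × AgreeHY x v) ×
                  (∀ v → T (f v) → Σ (V H) λ x → T (e x) × AgreeHY x v)

    -- p_XY(f) ∈ E(XY)
    InE-XY : Subset (V Y) → Set
    InE-XY f = Σ (Subset (V H)) λ eH → E H eH × ImgEqHY eH f ×
               ¬ (Σ (Subset (V H)) λ e'H → E H e'H × ImgStrictHH eH e'H)

    Claim : Set
    Claim = ∀ (eY : Subset (V Y)) → E Y eY →
      (Σ ((i : Fin m) → T (not (IX i)) → T (IY i) → V (Hs i)) λ xO →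
         ∀ v → T (eY v) → ∀ i hO hY → ρY i hY v ≡ xO i hO hY) →
      InE-XY eY

Lemma3p14 : Setting → Set
Lemma3p14 S =
  Claim (λ i → I-A i) C (λ i → I-C i) ρC ×
  Claim (λ i → I-A i) D (λ i → not (I-C i)) ρD ×
  Claim (λ i → not (I-A i)) C (λ i → I-C i) ρC ×
  Claim (λ i → not (I-A i)) D (λ i → not (I-C i)) ρD
  where open Setting S
        open Block S

-- Let X ∈ {A, B} and Y ∈ {C, D}, with complementary factors X′ and Y′.  Lifting
-- the edge e_Y of Y into the layer of H whose Y′-coordinate is a fixed d gives, by
-- the Cartesian part of the product, an edge e_H with p_XY(e_H) = p_XY(e_Y).  As
-- e_Y is constant in the coordinates of Y outside X, its vertices are told apart
-- by their XY-coordinates, so no edge whose XY-image contains that of e_H has a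
-- single vertex as image in X or in Y.  Given such an edge e′, cover p_Y(e′) by an
-- edge f of Y and lift f into the same layer, giving an edge g.  Since e_H is flat
-- in X′, p_X(e_H) is an edge of X; it lies in p_X(g), which lies in an edge of X,
-- so the antichain property forces p_X(g) = p_X(e_H), whence
-- p_XY(e′) ⊆ p_XY(g) ⊆ p_XY(e_H).
module Submission where

open import Defs
open import Data.Nat using (_≤_; _⊓_; z≤n; s≤s)
open import Data.Nat.Properties using (≤-trans; ≤-antisym; ≤-reflexive; ≤-refl; n≤1+n; ⊔-comm; ⊓-comm; ⊓-glb)
open import Data.Bool using (Bool; true; false; T; not; _∧_)
open import Data.Bool.Properties using (T-∧; not-involutive)
open import Data.Empty using (⊥-elim)
open import Data.Fin using (Fin)
open import Data.List using ([]; _∷_)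
open import Data.List.Membership.Propositional using (_∈_; find; lose)
open import Data.List.Relation.Unary.Any using (here; there)
open import Data.List.Relation.Unary.Any.Properties using (any⁺; any⁻)
open import Data.List.Relation.Unary.All using (lookup)
open import Data.List.Relation.Unary.AllPairs using (_∷_)
open import Data.List.Relation.Unary.Unique.Propositional using (Unique)
open import Data.Product using (Σ; _×_; _,_; proj₁; proj₂)
open import Data.Sum using (_⊎_; inj₁; inj₂; swap)
open import Relation.Nullary using (¬_; ⌊_⌋; yes; no)
open import Relation.Nullary.Decidable using (toWitness; fromWitness)
open import Relation.Binary.PropositionalEquality using (_≡_; _≢_; refl; sym; trans; cong; subst)
open import Function.Bundles using (_⇔_; Equivalence; mk⇔)

2≰1 : ¬ (2 ≤ 1)
2≰1 (s≤s ())

T-ext : ∀ {b c} → (T b → T c) → (T c → T b) → b ≡ c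
T-ext {true}  {true}  _ _ = refl
T-ext {true}  {false} f _ = ⊥-elim (f _)
T-ext {false} {true}  _ g = ⊥-elim (g _)
T-ext {false} {false} _ _ = refl

T-or-T-not : ∀ b → T b ⊎ T (not b)
T-or-T-not true  = inj₁ _
T-or-T-not false = inj₂ _

module _ {X : Set} (e : X → Bool) where

  countB-∷ : ∀ y ys → countB e ys ≤ countB e (y ∷ ys)
  countB-∷ y ys with e y
  ... | true  = n≤1+n _
  ... | false = ≤-refl

  countB-≥1 : ∀ {xs x} → x ∈ xs → T (e x) → 1 ≤ countB e xs
  countB-≥1 {y ∷ ys} (here refl) ex with e y
  ... | true = s≤s z≤n
  countB-≥1 {y ∷ ys} (there x∈ys) ex = ≤-trans (countB-≥1 x∈ys ex) (countB-∷ y ys)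

  countB-≥2 : ∀ {xs u w} → u ≢ w → u ∈ xs → w ∈ xs → T (e u) → T (e w) → 2 ≤ countB e xs
  countB-≥2 u≢w (here refl) (here refl) eu ew = ⊥-elim (u≢w refl)
  countB-≥2 {y ∷ ys} u≢w (here refl) (there w∈ys) eu ew with e y
  ... | true = s≤s (countB-≥1 w∈ys ew)
  countB-≥2 {y ∷ ys} u≢w (there u∈ys) (here refl) eu ew with e y
  ... | true = s≤s (countB-≥1 u∈ys eu)
  countB-≥2 {y ∷ ys} u≢w (there u∈ys) (there w∈ys) eu ew =
    ≤-trans (countB-≥2 u≢w u∈ys w∈ys eu ew) (countB-∷ y ys)

  countB-≡0 : ∀ {xs} → (∀ {x} → x ∈ xs → ¬ T (e x)) → countB e xs ≡ 0
  countB-≡0 {[]}     none = refl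
  countB-≡0 {y ∷ ys} none with e y in ey
  ... | true  = ⊥-elim (none (here refl) (subst T (sym ey) _))
  ... | false = countB-≡0 (λ x∈ys → none (there x∈ys))

  countB-≤1 : ∀ {xs} → Unique xs → (∀ {u w} → T (e u) → T (e w) → u ≡ w) → countB e xs ≤ 1
  countB-≤1 {[]}     _              _    = z≤n
  countB-≤1 {y ∷ ys} (y∉ys ∷ uniq) same with e y in ey
  ... | true  =
    s≤s (≤-reflexive (countB-≡0 λ x∈ys ex → lookup y∉ys x∈ys (same (subst T (sym ey) _) ex)))
  ... | false = countB-≤1 uniq same

  countB-≥1⇒∃ : ∀ {xs} → 1 ≤ countB e xs → Σ X λ x → x ∈ xs × T (e x)
  countB-≥1⇒∃ {y ∷ ys} c with e y in ey
  ... | true  = y , here refl , subst T (sym ey) _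
  ... | false = let (x , x∈ys , ex) = countB-≥1⇒∃ c in x , there x∈ys , ex

  countB-≥2⇒distinct : ∀ {xs} → Unique xs → 2 ≤ countB e xs →
                       Σ X λ u → Σ X λ w → u ≢ w × T (e u) × T (e w)
  countB-≥2⇒distinct {y ∷ ys} (y∉ys ∷ uniq) c with e y in ey
  countB-≥2⇒distinct {y ∷ ys} (y∉ys ∷ uniq) (s≤s c) | true =
    let (x , x∈ys , ex) = countB-≥1⇒∃ c in y , x , lookup y∉ys x∈ys , subst T (sym ey) _ , ex
  ... | false = countB-≥2⇒distinct uniq c

module _ (G : Hypergraph) where

  card≡1⇒≡ : ∀ {s} → card G s ≡ 1 → ∀ {u w} → T (s u) → T (s w) → u ≡ w
  card≡1⇒≡ {s} c {u} {w} su sw with _≟_ G u w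
  ... | yes u≡w = u≡w
  ... | no  u≢w = ⊥-elim (2≰1 (subst (2 ≤_) c (countB-≥2 s u≢w (complete G u) (complete G w) su sw)))

  card≤1 : ∀ {s} → (∀ {u w} → T (s u) → T (s w) → u ≡ w) → card G s ≤ 1
  card≤1 {s} = countB-≤1 s (unique G)

  card≡1 : ∀ {s d} → card G s ≤ 1 → T (s d) → card G s ≡ 1
  card≡1 {s} {d} s≤1 sd = ≤-antisym s≤1 (countB-≥1 s (complete G d) sd)

  edge-distinct : ∀ {e} → E G e → Σ (V G) λ u → Σ (V G) λ w → u ≢ w × T (e u) × T (e w)
  edge-distinct {e} Ee = countB-≥2⇒distinct e (unique G) (E-size G Ee)

module _ (G G′ : Hypergraph) (f : V G → V G′) where

  img-intro : ∀ {e z} → T (e z) → T (img G G′ f e (f z))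
  img-intro {e} {z} ez = any⁺ _ (lose (complete G z) (Equivalence.from T-∧ (ez , fromWitness refl)))

  img-elim : ∀ {e u} → T (img G G′ f e u) → Σ (V G) λ z → T (e z) × f z ≡ u
  img-elim {e} t with find (any⁻ _ (vertices G) t)
  ... | z , _ , t′ = let (ez , fz≡u) = Equivalence.to T-∧ t′ in z , ez , toWitness fz≡u

  card-img≤1 : ∀ {e} → (∀ {x y} → T (e x) → T (e y) → f x ≡ f y) → card G′ (img G G′ f e) ≤ 1
  card-img≤1 same = card≤1 G′ λ tu tw →
    let (x , ex , fx≡u) = img-elim tu
        (y , ey , fy≡w) = img-elim tw
    in trans (sym fx≡u) (trans (same ex ey) fy≡w)

ProductEdge-swap : ∀ k {G G₁ G₂ φ₁ φ₂ e} →
                   ProductEdge k G G₁ G₂ φ₁ φ₂ e → ProductEdge k G G₂ G₁ φ₂ φ₁ e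
ProductEdge-swap k      (inj₁ cart) = inj₁ (swap cart)
ProductEdge-swap strong {G} {G₁} {G₂} {φ₁} {φ₂} {e} (inj₂ (E₁ , E₂ , c)) =
  inj₂ (E₂ , E₁ , trans c (⊔-comm (card G₁ (img G G₁ φ₁ e)) (card G₂ (img G G₂ φ₂ e))))
ProductEdge-swap normal {G₁ = G₁} {G₂} (inj₂ (e₁ , e₂ , E₁ , E₂ , ⊆₁ , ⊆₂ , c , c₁ , c₂)) =
  inj₂ (e₂ , e₁ , E₂ , E₁ , ⊆₂ , ⊆₁ , trans c ⊓-swap , trans c₂ ⊓-swap , trans c₁ ⊓-swap)
  where
  ⊓-swap : card G₁ e₁ ⊓ card G₂ e₂ ≡ card G₂ e₂ ⊓ card G₁ e₁
  ⊓-swap = ⊓-comm (card G₁ e₁) (card G₂ e₂)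

IsProduct-swap : ∀ {k G G₁ G₂ φ₁ φ₂} → IsProduct k G G₁ G₂ φ₁ φ₂ → IsProduct k G G₂ G₁ φ₂ φ₁
IsProduct-swap {k} (inj , surj , edges) =
  (λ x y p q → inj x y q p) ,
  (λ a b → let (x , p , q) = surj b a in x , q , p) ,
  λ e → mk⇔ (λ Ee → ProductEdge-swap k (Equivalence.to (edges e) Ee))
            (λ pe → Equivalence.from (edges e) (ProductEdge-swap k pe))

module Product {k G G₁ G₂ φ₁ φ₂} (P : IsProduct k G G₁ G₂ φ₁ φ₂) where

  private
    surj : ∀ a b → Σ (V G) λ x → φ₁ x ≡ a × φ₂ x ≡ b
    surj = proj₁ (proj₂ P)

    edges : ∀ e → E G e ⇔ ProductEdge k G G₁ G₂ φ₁ φ₂ e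
    edges = proj₂ (proj₂ P)

  lift : V G₁ → V G₂ → V G
  lift a b = proj₁ (surj a b)

  φ₁-lift : ∀ a b → φ₁ (lift a b) ≡ a
  φ₁-lift a b = proj₁ (proj₂ (surj a b))

  φ₂-lift : ∀ a b → φ₂ (lift a b) ≡ b
  φ₂-lift a b = proj₂ (proj₂ (surj a b))

  layer : Subset (V G₁) → V G₂ → Subset (V G)
  layer f d z = f (φ₁ z) ∧ ⌊ _≟_ G₂ (φ₂ z) d ⌋

  ∈layer⁻ : ∀ f {d z} → T (layer f d z) → T (f (φ₁ z)) × φ₂ z ≡ d
  ∈layer⁻ f t = let (fz , z≡d) = Equivalence.to T-∧ t in fz , toWitness z≡d

  lift∈layer : ∀ {a} f d → T (f a) → T (layer f d (lift a d))
  lift∈layer {a} f d fa =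
    Equivalence.from T-∧ (subst (λ b → T (f b)) (sym (φ₁-lift a d)) fa , fromWitness (φ₂-lift a d))

  layer-edge : ∀ {f} d → E G₁ f → E G (layer f d)
  layer-edge {f} d Ef = Equivalence.from (edges (layer f d)) (inj₁ (inj₁ (E-img , card-img)))
    where
    E-img : E G₁ (img G G₁ φ₁ (layer f d))
    E-img = E-ext G₁ (λ a → T-ext (img-forth a) (img-back a)) Ef
      where
      img-forth : ∀ a → T (f a) → T (img G G₁ φ₁ (layer f d) a)
      img-forth a fa = subst (λ b → T (img G G₁ φ₁ (layer f d) b)) (φ₁-lift a d)
                         (img-intro G G₁ φ₁ (lift∈layer f d fa))
      img-back : ∀ a → T (img G G₁ φ₁ (layer f d) a) → T (f a)
      img-back a t = let (z , zf , φ₁z≡a) = img-elim G G₁ φ₁ t in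
                     subst (λ b → T (f b)) φ₁z≡a (proj₁ (∈layer⁻ f zf))
    card-img : card G₂ (img G G₂ φ₂ (layer f d)) ≡ 1
    card-img =
      let (u , _ , _ , fu , _) = edge-distinct G₁ Ef
      in card≡1 G₂
           (card-img≤1 G G₂ φ₂ λ zf z′f → trans (proj₂ (∈layer⁻ f zf)) (sym (proj₂ (∈layer⁻ f z′f))))
           (subst (λ b → T (img G G₂ φ₂ (layer f d) b)) (φ₂-lift u d)
                  (img-intro G G₂ φ₂ (lift∈layer f d fu)))

  edge-cover : ∀ {e} → E G e →
               (Σ (Subset (V G₁)) λ f → E G₁ f × img G G₁ φ₁ e ⊆ᵇ f) ⊎ card G₁ (img G G₁ φ₁ e) ≡ 1
  edge-cover {e} Ee = cover k (Equivalence.to (edges e) Ee)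
    where
    cover : ∀ k → ProductEdge k G G₁ G₂ φ₁ φ₂ e →
            (Σ (Subset (V G₁)) λ f → E G₁ f × img G G₁ φ₁ e ⊆ᵇ f) ⊎ card G₁ (img G G₁ φ₁ e) ≡ 1
    cover k      (inj₁ (inj₁ (E₁ , _))) = inj₁ (_ , E₁ , λ _ t → t)
    cover k      (inj₁ (inj₂ (_ , c₁))) = inj₂ c₁
    cover strong (inj₂ (E₁ , _))        = inj₁ (_ , E₁ , λ _ t → t)
    cover normal (inj₂ (e₁ , _ , E₁ , _ , ⊆₁ , _)) = inj₁ (e₁ , E₁ , ⊆₁)

  edge-flat : ∀ {e} → E G e → card G₂ (img G G₂ φ₂ e) ≤ 1 → E G₁ (img G G₁ φ₁ e)
  edge-flat {e} Ee c₂≤1 = flat k (Equivalence.to (edges e) Ee)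
    where
    flat : ∀ k → ProductEdge k G G₁ G₂ φ₁ φ₂ e → E G₁ (img G G₁ φ₁ e)
    flat k      (inj₁ (inj₁ (E₁ , _))) = E₁
    flat k      (inj₁ (inj₂ (E₂ , _))) = ⊥-elim (2≰1 (≤-trans (E-size G₂ E₂) c₂≤1))
    flat strong (inj₂ (_ , E₂ , _))    = ⊥-elim (2≰1 (≤-trans (E-size G₂ E₂) c₂≤1))
    flat normal (inj₂ (_ , _ , E₁ , E₂ , _ , _ , _ , _ , c₂)) =
      ⊥-elim (2≰1 (≤-trans (subst (2 ≤_) (sym c₂) (⊓-glb (E-size G₁ E₁) (E-size G₂ E₂))) c₂≤1))

module InSetting (S : Setting) where
  open Setting S
  open Block S

  AgreeOn : (Fin m → Bool) → V H → V H → Set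
  AgreeOn J x y = ∀ i → T (J i) → π i x ≡ π i y

  module _ {J : Fin m → Bool} {F : Hypergraph} {ρ : ∀ i → T (J i) → V F → V (Hs i)}
           {q : V H → V F} (q-coord : ∀ x i h → ρ i h (q x) ≡ π i x) where

    coord-≡⇒AgreeOn : ∀ {x y} → q x ≡ q y → AgreeOn J x y
    coord-≡⇒AgreeOn {x} {y} qx≡qy i h =
      trans (sym (q-coord x i h)) (trans (cong (ρ i h) qx≡qy) (q-coord y i h))

    AgreeOn⇒coord-≡ : CoordIso Hs J ρ → ∀ {x y} → AgreeOn J x y → q x ≡ q y
    AgreeOn⇒coord-≡ ρ-iso {x} {y} agree =
      proj₁ ρ-iso (q x) (q y) λ i h → trans (q-coord x i h) (trans (agree i h) (sym (q-coord y i h)))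

  -- One of A, B, C, D as a factor F of H ≅ F ⊠ F′, with I and I′ the index sets of F and F′.
  record Side : Set₁ where
    field
      I I′     : Fin m → Bool
      I∪I′     : ∀ i → T (I i) ⊎ T (I′ i)
      I′⊆∁I    : ∀ i → T (I′ i) → T (not (I i))
      F F′     : Hypergraph
      ρ        : ∀ i → T (I i) → V F → V (Hs i)
      ρ′       : ∀ i → T (I′ i) → V F′ → V (Hs i)
      ρ-iso    : CoordIso Hs I ρ
      ρ′-iso   : CoordIso Hs I′ ρ′
      p        : V H → V F
      p′       : V H → V F′
      p-coord  : ∀ x i h → ρ i h (p x) ≡ π i x
      p′-coord : ∀ x i h → ρ′ i h (p′ x) ≡ π i x
      product  : IsProduct (kindOf ⊠) H F F′ p p′

    open Product product public

    p≡⇒AgreeOn : ∀ {x y} → p x ≡ p y → AgreeOn I x y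
    p≡⇒AgreeOn = coord-≡⇒AgreeOn {F = F} {ρ = ρ} p-coord

    AgreeOn⇒p≡ : ∀ {x y} → AgreeOn I x y → p x ≡ p y
    AgreeOn⇒p≡ = AgreeOn⇒coord-≡ {F = F} {ρ = ρ} p-coord ρ-iso

    p′≡⇒AgreeOn : ∀ {x y} → p′ x ≡ p′ y → AgreeOn I′ x y
    p′≡⇒AgreeOn = coord-≡⇒AgreeOn {F = F′} {ρ = ρ′} p′-coord

    AgreeOn⇒p′≡ : ∀ {x y} → AgreeOn I′ x y → p′ x ≡ p′ y
    AgreeOn⇒p′≡ = AgreeOn⇒coord-≡ {F = F′} {ρ = ρ′} p′-coord ρ′-iso

    π-lift : ∀ a b i h → π i (lift a b) ≡ ρ i h a
    π-lift a b i h = trans (sym (p-coord (lift a b) i h)) (cong (ρ i h) (φ₁-lift a b))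

  module BlockClaim (σX σY : Side) where
    module X = Side σX
    module Y = Side σY

    _≈_ : V H → V H → Set
    _≈_ = AgreeHH X.I Y.F Y.I Y.ρ

    _⊑_ : Subset (V H) → Subset (V H) → Set
    _⊑_ = ImgSubHH X.I Y.F Y.I Y.ρ

    ≈-sym : ∀ {x y} → x ≈ y → y ≈ x
    ≈-sym x≈y i hX hY = sym (x≈y i hX hY)

    ≈-trans : ∀ {x y z} → x ≈ y → y ≈ z → x ≈ z
    ≈-trans x≈y y≈z i hX hY = trans (x≈y i hX hY) (y≈z i hX hY)

    ⊑-trans : ∀ {s t u} → s ⊑ t → t ⊑ u → s ⊑ u
    ⊑-trans s⊑t t⊑u x sx =
      let (y , ty , x≈y) = s⊑t x sx
          (z , uz , y≈z) = t⊑u y ty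
      in z , uz , ≈-trans x≈y y≈z

    X-p≡⇒≈ : ∀ {x y} → X.p x ≡ X.p y → x ≈ y
    X-p≡⇒≈ eq i hX _ = X.p≡⇒AgreeOn eq i hX

    Y-p≡⇒≈ : ∀ {x y} → Y.p x ≡ Y.p y → x ≈ y
    Y-p≡⇒≈ eq i _ hY = Y.p≡⇒AgreeOn eq i hY

    ≈⇒X-p≡ : ∀ {x y} → x ≈ y → Y.p′ x ≡ Y.p′ y → X.p x ≡ X.p y
    ≈⇒X-p≡ {x} {y} x≈y p′x≡p′y = X.AgreeOn⇒p≡ λ i hX → agree i hX (Y.I∪I′ i)
      where
      agree : ∀ i → T (X.I i) → T (Y.I i) ⊎ T (Y.I′ i) → π i x ≡ π i y
      agree i hX (inj₁ hY)  = x≈y i hX hY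
      agree i hX (inj₂ hY′) = Y.p′≡⇒AgreeOn p′x≡p′y i hY′

    img-⊆⇒⊑ : ∀ {s t} → img H X.F X.p t ⊆ᵇ img H X.F X.p s → t ⊑ s
    img-⊆⇒⊑ t⊆s x tx =
      let (z , sz , pz≡px) = img-elim H X.F X.p (t⊆s _ (img-intro H X.F X.p tx))
      in z , sz , X-p≡⇒≈ (sym pz≡px)

    Spread : Subset (V H) → Set
    Spread s = Σ (V H) λ x → Σ (V H) λ y → T (s x) × T (s y) × ¬ x ≈ y

    Spread-⊑ : ∀ {s t} → Spread s → s ⊑ t → Spread t
    Spread-⊑ (x , y , sx , sy , x≉y) s⊑t =
      let (x′ , tx′ , x≈x′) = s⊑t x sx
          (y′ , ty′ , y≈y′) = s⊑t y sy
      in x′ , y′ , tx′ , ty′ , λ x′≈y′ → x≉y (≈-trans x≈x′ (≈-trans x′≈y′ (≈-sym y≈y′)))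

    Spread⇒card≢1 : ∀ G (q : V H → V G) → (∀ {x y} → q x ≡ q y → x ≈ y) →
                    ∀ {s} → Spread s → card G (img H G q s) ≢ 1
    Spread⇒card≢1 G q q≡⇒≈ (x , y , sx , sy , x≉y) c =
      x≉y (q≡⇒≈ (card≡1⇒≡ G c (img-intro H G q sx) (img-intro H G q sy)))

    module LayerEdge (eY : Subset (V Y.F)) (EeY : E Y.F eY)
                     (xO : ∀ i → T (not (X.I i)) → T (Y.I i) → V (Hs i))
                     (eY-const : ∀ v → T (eY v) → ∀ i hO hY → Y.ρ i hY v ≡ xO i hO hY) where

      -- any Y′-coordinate would do
      d : V Y.F′
      d = Y.p′ (someVertex H)

      eH : Subset (V H)
      eH = Y.layer eY d

      InLayer : Subset (V H) → Set
      InLayer s = ∀ {z} → T (s z) → Y.p′ z ≡ d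

      layer-InLayer : ∀ f → InLayer (Y.layer f d)
      layer-InLayer f z∈ = proj₂ (Y.∈layer⁻ f z∈)

      ⊑⇒img-⊆ : ∀ {s t} → InLayer s → InLayer t → s ⊑ t → img H X.F X.p s ⊆ᵇ img H X.F X.p t
      ⊑⇒img-⊆ {s} {t} s-layer t-layer s⊑t u u∈ =
        let (x , sx , px≡u) = img-elim H X.F X.p u∈
            (y , ty , x≈y) = s⊑t x sx
            px≡py = ≈⇒X-p≡ x≈y (trans (s-layer sx) (sym (t-layer ty)))
        in subst (λ w → T (img H X.F X.p t w)) (trans (sym px≡py) px≡u) (img-intro H X.F X.p ty)

      eH-image : ImgEqHY X.I Y.F Y.I Y.ρ eH eY
      eH-image = (λ x ex → Y.p x , proj₁ (Y.∈layer⁻ eY ex) , λ i _ hY → sym (Y.p-coord x i hY))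
               , (λ v ev → Y.lift v d , Y.lift∈layer eY d ev , λ i _ hY → Y.π-lift v d i hY)

      eY-determined : ∀ {v w} → T (eY v) → T (eY w) →
                      (∀ i → T (X.I i) → (hY : T (Y.I i)) → Y.ρ i hY v ≡ Y.ρ i hY w) → v ≡ w
      eY-determined {v} {w} ev ew agree = proj₁ Y.ρ-iso v w λ i hY → coord i hY (T-or-T-not (X.I i))
        where
        coord : ∀ i hY → T (X.I i) ⊎ T (not (X.I i)) → Y.ρ i hY v ≡ Y.ρ i hY w
        coord i hY (inj₁ hX) = agree i hX hY
        coord i hY (inj₂ hO) = trans (eY-const v ev i hO hY) (sym (eY-const w ew i hO hY))

      eH-spread : Spread eH
      eH-spread =
        let (v , w , v≢w , ev , ew) = edge-distinct Y.F EeY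
        in Y.lift v d , Y.lift w d , Y.lift∈layer eY d ev , Y.lift∈layer eY d ew ,
           λ lv≈lw → v≢w (eY-determined ev ew λ i hX hY →
             trans (sym (Y.π-lift v d i hY)) (trans (lv≈lw i hX hY) (Y.π-lift w d i hY)))

      eH-const : ∀ {z} → T (eH z) → ∀ i hO hY → π i z ≡ xO i hO hY
      eH-const {z} ez i hO hY =
        trans (sym (Y.p-coord z i hY)) (eY-const (Y.p z) (proj₁ (Y.∈layer⁻ eY ez)) i hO hY)

      eH-flat : E X.F (img H X.F X.p eH)
      eH-flat = X.edge-flat (Y.layer-edge d EeY) (card-img≤1 H X.F′ X.p′ λ ex ey →
                  X.AgreeOn⇒p′≡ λ i h′ → agree ex ey i h′ (Y.I∪I′ i))
        where
        agree : ∀ {x y} → T (eH x) → T (eH y) → ∀ i → T (X.I′ i) → T (Y.I i) ⊎ T (Y.I′ i) → π i x ≡ π i y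
        agree ex ey i h′ (inj₁ hY)  =
          trans (eH-const ex i (X.I′⊆∁I i h′) hY) (sym (eH-const ey i (X.I′⊆∁I i h′) hY))
        agree ex ey i h′ (inj₂ hY′) =
          Y.p′≡⇒AgreeOn (trans (layer-InLayer eY ex) (sym (layer-InLayer eY ey))) i hY′

      ⊑-layer-edge : ∀ {e′} → E H e′ → Spread e′ → Σ (Subset (V Y.F)) λ f → E Y.F f × e′ ⊑ Y.layer f d
      ⊑-layer-edge Ee′ spread with Y.edge-cover Ee′
      ... | inj₂ c = ⊥-elim (Spread⇒card≢1 Y.F Y.p Y-p≡⇒≈ spread c)
      ... | inj₁ (f , Ef , e′⊆f) = f , Ef , λ x e′x →
            Y.lift (Y.p x) d , Y.lift∈layer f d (e′⊆f _ (img-intro H Y.F Y.p e′x)) ,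
            Y-p≡⇒≈ (sym (Y.φ₁-lift (Y.p x) d))

      eH-maximal-in-layer : ∀ {g} → E H g → InLayer g → eH ⊑ g → g ⊑ eH
      eH-maximal-in-layer {g} Eg g-layer eH⊑g with X.edge-cover Eg
      ... | inj₂ c = ⊥-elim (Spread⇒card≢1 X.F X.p X-p≡⇒≈ (Spread-⊑ eH-spread eH⊑g) c)
      ... | inj₁ (a , Ea , g⊆a) = img-⊆⇒⊑ λ u gu → subst T (sym (eH≡a u)) (g⊆a u gu)
        where
        eH≡a : ∀ u → img H X.F X.p eH u ≡ a u
        eH≡a = E-antichain X.F eH-flat Ea λ u eu → g⊆a u (⊑⇒img-⊆ (layer-InLayer eY) g-layer eH⊑g u eu)

      eH-maximal : ¬ (Σ (Subset (V H)) λ e′ → E H e′ × ImgStrictHH X.I Y.F Y.I Y.ρ eH e′)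
      eH-maximal (e′ , Ee′ , eH⊑e′ , e′⋢eH) =
        let (f , Ef , e′⊑g) = ⊑-layer-edge Ee′ (Spread-⊑ eH-spread eH⊑e′)
            g⊑eH = eH-maximal-in-layer (Y.layer-edge d Ef) (layer-InLayer f) (⊑-trans eH⊑e′ e′⊑g)
        in e′⋢eH (⊑-trans e′⊑g g⊑eH)

  block-claim : (σX σY : Side) → Claim (Side.I σX) (Side.F σY) (Side.I σY) (Side.ρ σY)
  block-claim σX σY eY EeY (xO , eY-const) = eH , Side.layer-edge σY d EeY , eH-image , eH-maximal
    where open BlockClaim.LayerEdge σX σY eY EeY xO eY-const

  sideA sideB sideC sideD : Side
  sideA = record
    { I = I-A ; I′ = λ i → not (I-A i) ; I∪I′ = λ i → T-or-T-not (I-A i) ; I′⊆∁I = λ _ h → h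
    ; F = A ; F′ = B ; ρ = ρA ; ρ′ = ρB ; ρ-iso = ρA-iso ; ρ′-iso = ρB-iso
    ; p = pA ; p′ = pB ; p-coord = pA-coord ; p′-coord = pB-coord ; product = H≅A⊠B }
  sideB = record
    { I = λ i → not (I-A i) ; I′ = I-A ; I∪I′ = λ i → swap (T-or-T-not (I-A i))
    ; I′⊆∁I = λ i h → subst T (sym (not-involutive (I-A i))) h
    ; F = B ; F′ = A ; ρ = ρB ; ρ′ = ρA ; ρ-iso = ρB-iso ; ρ′-iso = ρA-iso
    ; p = pB ; p′ = pA ; p-coord = pB-coord ; p′-coord = pA-coord ; product = IsProduct-swap H≅A⊠B }
  sideC = record
    { I = I-C ; I′ = λ i → not (I-C i) ; I∪I′ = λ i → T-or-T-not (I-C i) ; I′⊆∁I = λ _ h → h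
    ; F = C ; F′ = D ; ρ = ρC ; ρ′ = ρD ; ρ-iso = ρC-iso ; ρ′-iso = ρD-iso
    ; p = pC ; p′ = pD ; p-coord = pC-coord ; p′-coord = pD-coord ; product = H≅C⊠D }
  sideD = record
    { I = λ i → not (I-C i) ; I′ = I-C ; I∪I′ = λ i → swap (T-or-T-not (I-C i))
    ; I′⊆∁I = λ i h → subst T (sym (not-involutive (I-C i))) h
    ; F = D ; F′ = C ; ρ = ρD ; ρ′ = ρC ; ρ-iso = ρD-iso ; ρ′-iso = ρC-iso
    ; p = pD ; p′ = pC ; p-coord = pD-coord ; p′-coord = pC-coord ; product = IsProduct-swap H≅C⊠D }

lemma3p14 : (S : Setting) → Lemma3p14 S
lemma3p14 S =
  block-claim sideA sideC , block-claim sideA sideD , block-claim sideB sideC , block-claim sideB sideD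
  where open InSetting S
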